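{- Let $\mathcal M_{\mathcal I}$ be a $\Sigma^{\mathcal I}$-structure with an indefinitely large signature $\Sigma^{\mathcal I}$. Then $(\mathcal M_{\mathcal I},\models_m)$ is an indefinitely large model, and for each formula $\Phi(x_0,\dots,x_{n-1})$, each context $C\in\mathcal I^n$ with $C\vdash_m\Phi$ and all $\vec a\in\mathcal M_C$: $\mathcal M_{\mathcal I}\models_m\Phi[\vec a:C]$ iff $\bigcup\mathcal M_{\mathcal I}\models\Phi[\vec a]$ (ordinary Tarskian satisfaction).
   Context: $\mathcal I$: non-empty set with directed preorder $\le$; $\uparrow i=\{i'\ge i\}$. Contexts $C=(i_0,\dots,i_{n-1})\in\mathcal I^n$, $()$ empty, $Ci$ extension. $\mathfrak D_n\subseteq\mathcal P(\mathcal I^n)$: $\mathcal H\in\mathfrak D_0$ iff $\mathcal H=\{()\}$; $\mathcal H\in\mathfrak D_1$ iff $\uparrow i\subseteq\mathcal H$ for some $i$; for $\mathcal H\subseteq\mathcal I^{n+1}$, $\mathcal H\in\mathfrak D_{n+1}$ iff $\{C\in\mathcal I^n:\{i:Ci\in\mathcal H\}\in\mathfrak D_1\}\in\mathfrak D_n$. System $\mathcal M_{\mathcal I}=(\mathcal M_i)_{i\in\mathcal I}$: finite sets, $\mathcal M_i\subseteq\mathcal M_{i'}$ for $i\le i'$, at least one non-empty; $\mathcal M_C=\mathcal M_{i_0}\times\dots\times\mathcal M_{i_{n-1}}$. $n$-ary relation on it: family $(R_C)_{C\in\mathcal H}$, $\emptyset\ne\mathcal H\subseteq\mathcal I^n$,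 $R_C\subseteq\mathcal M_C$, with $R_C(\vec a)\iff R_{C'}(\vec a)$ on $\mathcal M_C\cap\mathcal M_{C'}$. $\Sigma$: first-order signature with relation symbols only; $\Sigma^{\mathcal I}$: assignments $R:C$, $C\in\mathcal I^{\mathrm{arity}(R)}$, at least one per symbol; indefinitely large iff $\{C:R:C\in\Sigma^{\mathcal I}\}\in\mathfrak D_n$ for every $n$-ary $R$. $\Sigma^{\mathcal I}$-structure: system plus, for each $R$, a relation $R_{\mathcal H}$ with $\mathcal H\supseteq\{C:R:C\in\Sigma^{\mathcal I}\}$, $R:C$ interpreted by $R_C$. $\bigcup\mathcal M_{\mathcal I}$ is the $\Sigma$-structure with carrier $\bigcup_i\mathcal M_i$ and each $R$ interpreted as $\bigcup_{C\in\mathcal H}R_C$. A $\ll$-relation: $(\ll_n)_n$ with $\ll_n\subseteq\mathcal I^n$ and $Ci\in\ll_{n+1}\Rightarrow C\in\ll_n$; indefinitely large iff $\ll_n\in\mathfrak D_n$ for all $n$; the trivial one is $\mathcal I^*=(\mathcal I^n)_n$. Formulas: first-order over $\Sigma$, variables $x_0,x_1,\dots$, $\bot,\to,\land,\lor,\forall,\exists$, no function symbols; $n$-ary formulas have free variables among $x_0,\dots,x_{n-1}$ and quantifiers bind $x_n$. State declarations $C\vdash_m\Phi$ (w.r.t. $\mathcal I^*$): $C\vdash_m\bot$ always; $C\vdash_m Rx_{k_0}\dots x_{k_{m-1}}$ iff some $j_0,\dots,j_{m-1}$ with $j_l\ge i_{k_l}$ have $R:(j_0,\dots,j_{m-1})\in\Sigma^{\mathcal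 I}$; $C\vdash_m\Phi\circ\Psi$ iff both components declared; $C\vdash_m\forall x\Psi$ iff $C\vdash_m\exists x\Psi$ iff $Ci\vdash_m\Psi$ for some $i\in\mathcal I$. The interpretation $\models_m$ for $C\vdash_m\Phi$, $\vec a\in\mathcal M_C$: atomic: $R_{(j_0,\dots,j_{m-1})}(a_{k_0},\dots,a_{k_{m-1}})$ for some $(j_0,\dots)$ as in the declaration; $\bot$ false; connectives classical; $\models_m\forall x\Phi[\vec a:C]$ iff $\models_m\Phi[\vec ab:Ci]$ for all $b\in\mathcal M_i$ and all $i\in\mathcal I$ (with $Ci\vdash_m\Phi$); $\models_m\exists x\Phi[\vec a:C]$ iff $\models_m\Phi[\vec ab:Ci]$ for some $b\in\mathcal M_i$, some $i$. A model $(\mathcal M_{\mathcal I},\models)$ built on a $\ll$-relation is indefinitely large iff the signature and the $\ll$-relation are indefinitely large; $(\mathcal M_{\mathcal I},\models_m)$ uses $\mathcal I^*$. -}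

module Defs where

open import Data.Nat using (ℕ; zero; suc)
open import Data.Fin using (Fin)
open import Data.Vec using (Vec; []; _∷_; _∷ʳ_; lookup; map)
open import Data.Vec.Relation.Binary.Pointwise.Inductive using (Pointwise)
open import Data.List using (List)
open import Data.List.Membership.Propositional using (_∈_)
open import Data.Product using (Σ; ∃; _×_; _,_)
open import Data.Sum using (_⊎_)
open import Data.Empty using (⊥)
open import Data.Unit using (⊤)
open import Function.Bundles using (_⇔_)

record DirectedPreorder : Set₁ where
  field
    Carrier   : Set
    _≤_       : Carrier → Carrier → Set
    ≤-refl    : ∀ {i} → i ≤ i
    ≤-trans   : ∀ {i j k} → i ≤ j → j ≤ k → i ≤ k
    directed  : ∀ i j → ∃ λ k → (i ≤ k) × (j ≤ k)
    inhabited : Carrier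

-- First-order relational signatures and formulas.
-- Formula n = n-ary formulas (free variables among x_0..x_{n-1});
-- a quantifier applied to a Formula (suc n) binds the variable x_n.

record Signature : Set₁ where
  field
    Sym   : Set
    arity : Sym → ℕ

module _ (Sig : Signature) where
  open Signature Sig

  data Formula : ℕ → Set where
    ⊥'   : ∀ {n} → Formula n
    rel  : ∀ {n} (R : Sym) → Vec (Fin n) (arity R) → Formula n
    _⇒'_ : ∀ {n} → Formula n → Formula n → Formula n
    _∧'_ : ∀ {n} → Formula n → Formula n → Formula n
    _∨'_ : ∀ {n} → Formula n → Formula n → Formula n
    ∀'   : ∀ {n} → Formula (suc n) → Formula n
    ∃'   : ∀ {n} → Formula (suc n) → Formula n

module _ (𝓘 : DirectedPreorder) where
  open DirectedPreorder 𝓘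

  -- contexts C ∈ 𝓘ⁿ; the extension C i is  C ∷ʳ i
  Ctx : ℕ → Set
  Ctx n = Vec Carrier n

  Eventually : (Carrier → Set) → Set
  Eventually P = ∃ λ i → ∀ i' → i ≤ i' → P i'

  𝔇 : (n : ℕ) → (Ctx n → Set) → Set
  𝔇 zero    ℋ = ℋ []
  𝔇 (suc n) ℋ = 𝔇 n (λ C → Eventually (λ i → ℋ (C ∷ʳ i)))

  record ≪-Relation : Set₁ where
    field
      ≪       : (n : ℕ) → Ctx n → Set
      prefix  : ∀ {n} (C : Ctx n) (i : Carrier) → ≪ (suc n) (C ∷ʳ i) → ≪ n C

  IndefinitelyLarge≪ : ≪-Relation → Set
  IndefinitelyLarge≪ r = ∀ n → 𝔇 n (≪-Relation.≪ r n)

  𝓘* : ≪-Relation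
  𝓘* = record { ≪ = λ _ _ → ⊤ ; prefix = λ _ _ _ → Data.Unit.tt }

  module _ (Sig : Signature) where
    open Signature Sig

    record IndexedSignature : Set₁ where
      field
        Assigned   : (R : Sym) → Ctx (arity R) → Set
        atLeastOne : ∀ R → ∃ λ C → Assigned R C

    IndefinitelyLargeSig : IndexedSignature → Set
    IndefinitelyLargeSig Σᴵ = ∀ R → 𝔇 (arity R) (IndexedSignature.Assigned Σᴵ R)

    record System : Set₁ where
      field
        U        : Set
        𝓜        : Carrier → U → Set
        finite   : ∀ i → ∃ λ (xs : List U) → ∀ a → 𝓜 i a ⇔ a ∈ xs
        mono     : ∀ {i i' a} → i ≤ i' → 𝓜 i a → 𝓜 i' a
        nonempty : ∃ λ i → ∃ λ a → 𝓜 i a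

      InCtx : ∀ {n} → Ctx n → Vec U n → Set
      InCtx C as = Pointwise 𝓜 C as

      InUnion : U → Set
      InUnion a = ∃ λ i → 𝓜 i a

    -- Σ^𝓘-structures: for each R a relation R_ℋ (ℋ = Dom R) on the system
    record Structure (Σᴵ : IndexedSignature) : Set₁ where
      open IndexedSignature Σᴵ
      field
        system : System
      open System system public
      field
        Dom         : (R : Sym) → Ctx (arity R) → Set
        domNonEmpty : ∀ R → ∃ λ C → Dom R C
        dom⊇        : ∀ {R C} → Assigned R C → Dom R C
        Rel         : (R : Sym) → Ctx (arity R) → Vec U (arity R) → Set
        relInCtx    : ∀ {R C as} → Dom R C → Rel R C as → InCtx C as
        coherent    : ∀ {R C C' as} → Dom R C → Dom R C' → InCtx C as → InCtx C' as →
                      Rel R C as ⇔ Rel R C' as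

      -- state declarations  C ⊢ₘ Φ  (w.r.t. 𝓘*)
      Decl : ∀ {n} → Ctx n → Formula Sig n → Set
      Decl C ⊥'         = ⊤
      Decl C (rel R ks) = ∃ λ (js : Ctx (arity R)) →
                            Pointwise (λ k j → lookup C k ≤ j) ks js × Assigned R js
      Decl C (Φ ⇒' Ψ)   = Decl C Φ × Decl C Ψ
      Decl C (Φ ∧' Ψ)   = Decl C Φ × Decl C Ψ
      Decl C (Φ ∨' Ψ)   = Decl C Φ × Decl C Ψ
      Decl C (∀' Φ)     = ∃ λ i → Decl (C ∷ʳ i) Φ
      Decl C (∃' Φ)     = ∃ λ i → Decl (C ∷ʳ i) Φ

      Sat : ∀ {n} → Ctx n → Formula Sig n → Vec U n → Set
      Sat C ⊥'         as = ⊥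
      Sat C (rel R ks) as = ∃ λ (js : Ctx (arity R)) →
                              Pointwise (λ k j → lookup C k ≤ j) ks js × Assigned R js ×
                              Rel R js (map (lookup as) ks)
      Sat C (Φ ⇒' Ψ)   as = Sat C Φ as → Sat C Ψ as
      Sat C (Φ ∧' Ψ)   as = Sat C Φ as × Sat C Ψ as
      Sat C (Φ ∨' Ψ)   as = Sat C Φ as ⊎ Sat C Ψ as
      Sat C (∀' Φ)     as = ∀ i → Decl (C ∷ʳ i) Φ → ∀ b → 𝓜 i b → Sat (C ∷ʳ i) Φ (as ∷ʳ b)
      Sat C (∃' Φ)     as = ∃ λ i → Decl (C ∷ʳ i) Φ × ∃ λ b → 𝓜 i b × Sat (C ∷ʳ i) Φ (as ∷ʳ b)

      Tarski : ∀ {n} → Formula Sig n → Vec U n → Set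
      Tarski ⊥'         as = ⊥
      Tarski (rel R ks) as = ∃ λ C → Dom R C × Rel R C (map (lookup as) ks)
      Tarski (Φ ⇒' Ψ)   as = Tarski Φ as → Tarski Ψ as
      Tarski (Φ ∧' Ψ)   as = Tarski Φ as × Tarski Ψ as
      Tarski (Φ ∨' Ψ)   as = Tarski Φ as ⊎ Tarski Ψ as
      Tarski (∀' Φ)     as = ∀ b → InUnion b → Tarski Φ (as ∷ʳ b)
      Tarski (∃' Φ)     as = ∃ λ b → InUnion b × Tarski Φ (as ∷ʳ b)

    -- (𝓜_𝓘, ⊨ₘ) is built on 𝓘*; it is indefinitely large iff the signature
    -- and 𝓘* are indefinitely large
    IndefinitelyLargeModelₘ : IndexedSignature → Set
    IndefinitelyLargeModelₘ Σᴵ = IndefinitelyLargeSig Σᴵ × IndefinitelyLarge≪ 𝓘*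

-- Over an indefinitely large signature every formula is declared in every
-- context: an indefinitely large set of contexts meets the cone above any
-- context, so each atom R x_k... has an assignment R : js dominating its
-- variables' indices.  At an atom, coherence lets us move
-- between the witness R_C of the union and the relation R_js of the
-- declaration; at a quantifier, an element b of 𝓜_i is exactly an element of
-- the union seen at stage i.
module Submission where

open import Defs
open import Data.Nat using (ℕ; zero; suc)
open import Data.Fin using (Fin)
open import Data.Vec using (Vec; []; _∷_; _∷ʳ_; lookup; map; initLast)
open import Data.Vec.Relation.Binary.Pointwise.Inductive as Pointwise
  using (Pointwise; []; _∷_)
open import Data.Product using (_×_; _,_; ∃)
open import Data.Product.Function.NonDependent.Propositional using (_×-⇔_)
open import Data.Sum.Function.Propositional using (_⊎-⇔_)
open import Data.Unit using (tt)
open import Function.Bundles using (_⇔_; mk⇔; Equivalence)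
open import Function.Related.TypeIsomorphisms using (→-cong-⇔)
open import Relation.Binary.PropositionalEquality using (refl)

module _ {A B : Set} {R : A → B → Set} where

  ∷ʳ⁺ : ∀ {n} {xs : Vec A n} {ys : Vec B n} {x y} →
        Pointwise R xs ys → R x y → Pointwise R (xs ∷ʳ x) (ys ∷ʳ y)
  ∷ʳ⁺ []          r = r ∷ []
  ∷ʳ⁺ (p ∷ xs∼ys) r = p ∷ ∷ʳ⁺ xs∼ys r

  map⁻ : ∀ {C : Set} {f : C → A} {n} {xs : Vec C n} {ys : Vec B n} →
         Pointwise R (map f xs) ys → Pointwise (λ x y → R (f x) y) xs ys
  map⁻ {xs = []}    []           = []
  map⁻ {xs = _ ∷ _} (p ∷ fxs∼ys) = p ∷ map⁻ fxs∼ys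

module _ (𝓘 : DirectedPreorder) where
  open DirectedPreorder 𝓘

  𝔇-full : ∀ n {ℋ : Ctx 𝓘 n → Set} → (∀ C → ℋ C) → 𝔇 𝓘 n ℋ
  𝔇-full zero    ℋ-all = ℋ-all []
  𝔇-full (suc n) ℋ-all = 𝔇-full n (λ C → inhabited , λ i _ → ℋ-all (C ∷ʳ i))

  𝔇-cofinal : ∀ n {ℋ : Ctx 𝓘 n → Set} → 𝔇 𝓘 n ℋ →
              (C : Ctx 𝓘 n) → ∃ λ (D : Ctx 𝓘 n) → Pointwise _≤_ C D × ℋ D
  𝔇-cofinal zero    ℋ∈𝔇 [] = [] , [] , ℋ∈𝔇
  𝔇-cofinal (suc n) ℋ∈𝔇 C with initLast C
  ... | C′ , i , refl with 𝔇-cofinal n ℋ∈𝔇 C′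
  ... | D , C′≤D , j , ℋ↑j with directed i j
  ... | k , i≤k , j≤k = D ∷ʳ k , ∷ʳ⁺ C′≤D i≤k , ℋ↑j k j≤k

  𝓘*-indefinitelyLarge : IndefinitelyLarge≪ 𝓘 (𝓘* 𝓘)
  𝓘*-indefinitelyLarge n = 𝔇-full n (λ _ → tt)

module _ {𝓘 : DirectedPreorder} {Sig : Signature} {Σᴵ : IndexedSignature 𝓘 Sig}
         (𝔐 : Structure 𝓘 Sig Σᴵ) where
  open DirectedPreorder 𝓘 using (_≤_; inhabited)
  open Signature Sig using (Sym; arity)
  open IndexedSignature Σᴵ
  open Structure 𝔐

  InCtx-mono : ∀ {n} {C D : Ctx 𝓘 n} {as} → Pointwise _≤_ C D → InCtx C as → InCtx D as
  InCtx-mono []          []            = []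
  InCtx-mono (i≤j ∷ C≤D) (a∈𝓜ᵢ ∷ as∈C) = mono i≤j a∈𝓜ᵢ ∷ InCtx-mono C≤D as∈C

  InCtx-select : ∀ {n m} {C : Ctx 𝓘 n} {as} → InCtx C as →
                 (ks : Vec (Fin n) m) → InCtx (map (lookup C) ks) (map (lookup as) ks)
  InCtx-select as∈C []       = []
  InCtx-select as∈C (k ∷ ks) = Pointwise.lookup as∈C k ∷ InCtx-select as∈C ks

  module _ (large : IndefinitelyLargeSig 𝓘 Sig Σᴵ) where

    assigned-above : ∀ {m} (R : Sym) (C : Ctx 𝓘 m) (ks : Vec (Fin m) (arity R)) →
                     ∃ λ (js : Ctx 𝓘 (arity R)) →
                       Pointwise _≤_ (map (lookup C) ks) js × Assigned R js
    assigned-above R C ks = 𝔇-cofinal 𝓘 _ (large R) (map (lookup C) ks)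

    Decl-total : ∀ {n} (C : Ctx 𝓘 n) Φ → Decl C Φ
    Decl-total C ⊥'         = tt
    Decl-total C (rel R ks) with assigned-above R C ks
    ... | js , C≤js , assigned = js , map⁻ C≤js , assigned
    Decl-total C (Φ ⇒' Ψ)   = Decl-total C Φ , Decl-total C Ψ
    Decl-total C (Φ ∧' Ψ)   = Decl-total C Φ , Decl-total C Ψ
    Decl-total C (Φ ∨' Ψ)   = Decl-total C Φ , Decl-total C Ψ
    Decl-total C (∀' Φ)     = inhabited , Decl-total _ Φ
    Decl-total C (∃' Φ)     = inhabited , Decl-total _ Φ

    Sat⇔Tarski : ∀ {n} (Φ : Formula Sig n) {C : Ctx 𝓘 n} {as} → InCtx C as →
                 Sat C Φ as ⇔ Tarski Φ as
    Sat⇔Tarski ⊥'         _    = mk⇔ (λ ()) (λ ())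
    Sat⇔Tarski (rel R ks) {C} {as} as∈C = mk⇔
      (λ (js , _ , assigned , r) → js , dom⊇ assigned , r)
      from
      where
      from : Tarski (rel R ks) as → Sat C (rel R ks) as
      from (D , D∈Dom , r) with assigned-above R C ks
      ... | js , C≤js , assigned = js , map⁻ C≤js , assigned ,
        Equivalence.to (coherent D∈Dom (dom⊇ assigned) (relInCtx D∈Dom r)
                                 (InCtx-mono C≤js (InCtx-select as∈C ks))) r
    Sat⇔Tarski (Φ ⇒' Ψ)   as∈C = →-cong-⇔ (Sat⇔Tarski Φ as∈C) (Sat⇔Tarski Ψ as∈C)
    Sat⇔Tarski (Φ ∧' Ψ)   as∈C = Sat⇔Tarski Φ as∈C ×-⇔ Sat⇔Tarski Ψ as∈C
    Sat⇔Tarski (Φ ∨' Ψ)   as∈C = Sat⇔Tarski Φ as∈C ⊎-⇔ Sat⇔Tarski Ψ as∈C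
    Sat⇔Tarski (∀' Φ) {C} {as} as∈C = mk⇔
      (λ sat b (i , b∈𝓜ᵢ) → Equivalence.to (Φ⇔ b∈𝓜ᵢ) (sat i (Decl-total _ Φ) b b∈𝓜ᵢ))
      (λ tarski i _ b b∈𝓜ᵢ → Equivalence.from (Φ⇔ b∈𝓜ᵢ) (tarski b (i , b∈𝓜ᵢ)))
      where
      Φ⇔ : ∀ {i b} → 𝓜 i b → Sat (C ∷ʳ i) Φ (as ∷ʳ b) ⇔ Tarski Φ (as ∷ʳ b)
      Φ⇔ b∈𝓜ᵢ = Sat⇔Tarski Φ (∷ʳ⁺ as∈C b∈𝓜ᵢ)
    Sat⇔Tarski (∃' Φ) {C} {as} as∈C = mk⇔
      (λ (i , _ , b , b∈𝓜ᵢ , sat) → b , (i , b∈𝓜ᵢ) , Equivalence.to (Φ⇔ b∈𝓜ᵢ) sat)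
      (λ (b , (i , b∈𝓜ᵢ) , tarski) →
         i , Decl-total _ Φ , b , b∈𝓜ᵢ , Equivalence.from (Φ⇔ b∈𝓜ᵢ) tarski)
      where
      Φ⇔ : ∀ {i b} → 𝓜 i b → Sat (C ∷ʳ i) Φ (as ∷ʳ b) ⇔ Tarski Φ (as ∷ʳ b)
      Φ⇔ b∈𝓜ᵢ = Sat⇔Tarski Φ (∷ʳ⁺ as∈C b∈𝓜ᵢ)

lemma4p5 : (𝓘 : DirectedPreorder) (Sig : Signature) (Σᴵ : IndexedSignature 𝓘 Sig)
           (𝓜 : Structure 𝓘 Sig Σᴵ) →
           IndefinitelyLargeSig 𝓘 Sig Σᴵ →
           IndefinitelyLargeModelₘ 𝓘 Sig Σᴵ ×
           (∀ (n : ℕ) (Φ : Formula Sig n) (C : Ctx 𝓘 n) → Structure.Decl 𝓜 C Φ →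
             (as : Vec (Structure.U 𝓜) n) → Structure.InCtx 𝓜 C as →
             Structure.Sat 𝓜 C Φ as ⇔ Structure.Tarski 𝓜 Φ as)
lemma4p5 𝓘 Sig Σᴵ 𝓜 large =
  (large , 𝓘*-indefinitelyLarge 𝓘) ,
  λ _ Φ _ _ _ as∈C → Sat⇔Tarski 𝓜 large Φ as∈C
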